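{- Let $\varphi$ be a formula built from atomic variables and the constants $0,1$ using only $\vee,\wedge,\Rightarrow$, and let $\pi$ be an atomic variable not occurring in $\varphi$. Define the double $\pi$-negation transform of $\varphi$ as the formula obtained by replacing each atomic variable $\sigma$ of $\varphi$ by $(\sigma\Rightarrow\pi)\Rightarrow\pi$ and the constant $0$ by $\pi$ (leaving $\vee,\wedge,\Rightarrow$ and $1$ unchanged). If $\varphi$ is a subset tautology, then its double $\pi$-negation transform is a partition tautology.
   Context: Subset semantics: for a nonempty set $U$, assign subsets of $U$ to variables, $0=\emptyset$, $1=U$, $\vee=\cup$, $\wedge=\cap$, $A\Rightarrow B=(U\setminus A)\cup B$; a subset tautology evaluates to $U$ for all nonempty $U$ and all assignments. Partition semantics: for a set $U$ with $|U|\ge2$, assign partitions on $U$ (sets of nonempty pairwise disjoint blocks with union $U$) to the variables; with $\operatorname{dit}(\pi)$ the ordered pairs in different blocks, $\overline S$ the smallest equivalence relation containing $S\subseteq U\times U$ and $\operatorname{int}(S)=U\times U\setminus\overline{U\times U\setminus S}$: $0=\{U\}$, $1$ = discrete partition, $\operatorname{dit}(\sigma\vee\tau)=\operatorname{dit}\sigma\cup\operatorname{dit}\tau$, $\operatorname{dit}(\sigma\wedge\tau)=\operatorname{int}(\operatorname{dit}\sigma\cap\operatorname{dit}\tau)$, $\operatorname{dit}(\sigma\Rightarrow\tau)=\operatorname{int}((U\times U\setminus\operatorname{dit}\sigma)\cup\operatorname{dit}\tau)$. A partition tautology evaluates to $1$ for all $U$ with $|U|\ge2$ and all assignments. -}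

module Defs where

open import Level using (0ℓ)
open import Data.Nat using (ℕ)
open import Data.Empty using (⊥)
open import Data.Unit using (⊤)
open import Data.Sum using (_⊎_)
open import Data.Product using (_×_; Σ; ∃; ∃-syntax; _,_; proj₁)
open import Relation.Nullary using (¬_)
open import Relation.Binary using (Rel; IsEquivalence)
open import Relation.Binary.PropositionalEquality using (_≡_)
open import Relation.Binary.Construct.Closure.Equivalence using (EqClosure)
open import Function.Bundles using (_⇔_)

infixr 6 _∧'_
infixr 5 _∨'_
infixr 4 _⇒'_
data Formula : Set where
  var  : ℕ → Formula
  zero' : Formula
  one'  : Formula
  _∨'_ : Formula → Formula → Formula
  _∧'_ : Formula → Formula → Formula
  _⇒'_ : Formula → Formula → Formula

Occurs : ℕ → Formula → Set
Occurs p (var q) = p ≡ q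
Occurs p zero' = ⊥
Occurs p one' = ⊥
Occurs p (φ ∨' ψ) = Occurs p φ ⊎ Occurs p ψ
Occurs p (φ ∧' ψ) = Occurs p φ ⊎ Occurs p ψ
Occurs p (φ ⇒' ψ) = Occurs p φ ⊎ Occurs p ψ

dnTransform : ℕ → Formula → Formula
dnTransform p (var q) = (var q ⇒' var p) ⇒' var p
dnTransform p zero' = var p
dnTransform p one' = one'
dnTransform p (φ ∨' ψ) = dnTransform p φ ∨' dnTransform p ψ
dnTransform p (φ ∧' ψ) = dnTransform p φ ∧' dnTransform p ψ
dnTransform p (φ ⇒' ψ) = dnTransform p φ ⇒' dnTransform p ψ

Subset : Set → Set₁
Subset U = U → Set

evalSub : {U : Set} → (ℕ → Subset U) → Formula → Subset U
evalSub ρ (var q) = ρ q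
evalSub ρ zero' = λ _ → ⊥
evalSub ρ one' = λ _ → ⊤
evalSub ρ (φ ∨' ψ) = λ x → evalSub ρ φ x ⊎ evalSub ρ ψ x
evalSub ρ (φ ∧' ψ) = λ x → evalSub ρ φ x × evalSub ρ ψ x
evalSub ρ (φ ⇒' ψ) = λ x → (¬ evalSub ρ φ x) ⊎ evalSub ρ ψ x

SubsetTautology : Formula → Set₁
SubsetTautology φ =
  (U : Set) → U → (ρ : ℕ → Subset U) → (x : U) → evalSub ρ φ x

-- Partition semantics.  A partition on U is given by its equivalence
-- relation "in the same block"; dit(π) is the complement of it.

record Partition (U : Set) : Set₁ where
  field
    same  : Rel U 0ℓ
    isEquivalence : IsEquivalence same

dit : {U : Set} → Partition U → Rel U 0ℓ
dit P u v = ¬ Partition.same P u v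

compl : {U : Set} → Rel U 0ℓ → Rel U 0ℓ
compl S u v = ¬ S u v

int : {U : Set} → Rel U 0ℓ → Rel U 0ℓ
int S = compl (EqClosure (compl S))

-- dit-set of the value of a formula under a partition assignment.
evalDit : {U : Set} → (ℕ → Partition U) → Formula → Rel U 0ℓ
evalDit ρ (var q) = dit (ρ q)
evalDit ρ zero' = λ _ _ → ⊥                       -- dit of {U}
evalDit ρ one' = λ u v → ¬ u ≡ v                   -- dit of discrete partition
evalDit ρ (φ ∨' ψ) = λ u v → evalDit ρ φ u v ⊎ evalDit ρ ψ u v
evalDit ρ (φ ∧' ψ) = int (λ u v → evalDit ρ φ u v × evalDit ρ ψ u v)
evalDit ρ (φ ⇒' ψ) = int (λ u v → compl (evalDit ρ φ) u v ⊎ evalDit ρ ψ u v)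

PartitionTautology : Formula → Set₁
PartitionTautology φ =
  (U : Set) → (Σ U λ a → Σ U λ b → ¬ a ≡ b) → (ρ : ℕ → Partition U) →
  (u v : U) → evalDit ρ φ u v ⇔ (¬ u ≡ v)

-- Fix a block B of π. For every formula φ, the dit-set of its transform
-- contains dit(π), and inside B it is either all pairs of distinct points
-- or no pair at all; which one is decided by evaluating φ classically,
-- reading a variable σ as true iff σ splits B. The variable case holds
-- because σ ⇒ π is indiscrete on B exactly when σ splits B: the dits of a
-- partition that splits B connect all of B. Taking B to be the block of u,
-- a subset tautology gives every distinct pair in B as a dit; pairs in
-- different blocks are dits of π.

module Submission where

open import Defs
open import Level using (0ℓ)
open import Data.Nat using (ℕ)
open import Data.Empty using (⊥; ⊥-elim)
open import Data.Unit using (⊤; tt)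
open import Data.Sum using (_⊎_; inj₁; inj₂; [_,_])
open import Data.Product using (_×_; ∃₂; _,_; proj₁; proj₂)
open import Function.Base using (id; _∘_)
open import Function.Bundles using (mk⇔)
open import Relation.Nullary using (¬_; yes; no)
open import Relation.Binary using (Rel; IsEquivalence; _⇒_)
open import Relation.Binary.PropositionalEquality as ≡ using (_≡_; _≢_; refl)
open import Relation.Binary.Construct.Closure.Equivalence as EqClosure using (EqClosure)
open import Relation.Binary.Construct.Closure.ReflexiveTransitive using (_◅◅_)
open import Axiom.ExcludedMiddle using (ExcludedMiddle)
open import Axiom.DoubleNegationElimination using (em⇒dne)

evalDit-irreflexive : {U : Set} (ρ : ℕ → Partition U) (φ : Formula) (x : U) →
  ¬ evalDit ρ φ x x
evalDit-irreflexive ρ (var q) x d = d (IsEquivalence.refl (Partition.isEquivalence (ρ q)))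
evalDit-irreflexive ρ zero' x d = d
evalDit-irreflexive ρ one' x d = d refl
evalDit-irreflexive ρ (φ ∨' ψ) x (inj₁ d) = evalDit-irreflexive ρ φ x d
evalDit-irreflexive ρ (φ ∨' ψ) x (inj₂ d) = evalDit-irreflexive ρ ψ x d
evalDit-irreflexive ρ (φ ∧' ψ) x d = d (EqClosure.reflexive _)
evalDit-irreflexive ρ (φ ⇒' ψ) x d = d (EqClosure.reflexive _)

module _ {U : Set} where

  Block : Partition U → U → U → Set
  Block P u x = Partition.same P x u

  DiscreteOn IndiscreteOn : (U → Set) → Rel U 0ℓ → Set
  DiscreteOn B R = ∀ {x y} → B x → B y → x ≢ y → R x y
  IndiscreteOn B R = DiscreteOn B (compl R)

  Splits : Partition U → (U → Set) → Set
  Splits σ B = ∃₂ λ a b → B a × B b × dit σ a b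

  CollapseOutside : (U → Set) → Rel U 0ℓ
  CollapseOutside B a b = (B a → a ≡ b) × (B b → a ≡ b)

  collapseOutside-isEquivalence : (B : U → Set) → IsEquivalence (CollapseOutside B)
  collapseOutside-isEquivalence B = record
    { refl  = (λ _ → refl) , (λ _ → refl)
    ; sym   = λ (ab , ba) → ≡.sym ∘ ba , ≡.sym ∘ ab
    ; trans = λ (ab , ba) (bc , cb) →
        (λ a → let a≡b = ab a in ≡.trans a≡b (bc (≡.subst B a≡b a)))
      , (λ c → let b≡c = cb c in ≡.trans (ba (≡.subst B (≡.sym b≡c) c)) b≡c)
    }

  int⇒¬¬ : {S : Rel U 0ℓ} {x y : U} → int S x y → ¬ ¬ S x y
  int⇒¬¬ i nS = i (EqClosure.return nS)

  int-preserves-indiscrete : {B : U → Set} {S : Rel U 0ℓ} → IndiscreteOn B S → IndiscreteOn B (int S)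
  int-preserves-indiscrete indiscrete bx by x≢y i = int⇒¬¬ i (indiscrete bx by x≢y)

  DitPath : Partition U → (U → Set) → Rel U 0ℓ
  DitPath σ B = EqClosure (λ c d → B c × B d × dit σ c d)

  ditPath-detour : (σ : Partition U) {B : U → Set} {x y c : U} → Partition.same σ x y →
    B x → B y → B c → dit σ x c → DitPath σ B x y
  ditPath-detour σ x∼y bx by bc x≁c =
    EqClosure.return (bx , bc , x≁c)
      ◅◅ EqClosure.symmetric _ (EqClosure.return (by , bc , x≁c ∘ trans x∼y))
    where open IsEquivalence (Partition.isEquivalence σ)

  module _ (em : ExcludedMiddle 0ℓ) where

    private
      dne = em⇒dne em

    dit⊆int : (P : Partition U) {S : Rel U 0ℓ} → dit P ⇒ S → dit P ⇒ int S
    dit⊆int P ditP⊆S notSame path =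
      notSame (EqClosure.fold (Partition.isEquivalence P) (λ nS → dne (nS ∘ ditP⊆S)) path)

    -- Outside dit P the complement of S only joins equal points inside the
    -- block, so its equivalence closure cannot join two distinct ones.
    int-preserves-discrete : (P : Partition U) (u : U) {S : Rel U 0ℓ} → dit P ⇒ S →
      DiscreteOn (Block P u) S → DiscreteOn (Block P u) (int S)
    int-preserves-discrete P u {S} ditP⊆S discrete bx by x≢y path =
      x≢y (proj₁ (EqClosure.fold (collapseOutside-isEquivalence (Block P u)) collapse path) bx)
      where
      open IsEquivalence (Partition.isEquivalence P)
      collapse : compl S ⇒ CollapseOutside (Block P u)
      collapse {a} {c} nS = (λ ba → equal ba (trans (sym sameAC) ba))
                          , (λ bc → equal (trans sameAC bc) bc)
        where
        sameAC : Partition.same P a c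
        sameAC = dne (nS ∘ ditP⊆S)
        equal : Block P u a → Block P u c → a ≡ c
        equal ba bc = dne (nS ∘ discrete ba bc)

    splits⇒dit-connected : (σ : Partition U) {B : U → Set} → Splits σ B →
      ∀ {x y} → B x → B y → DitPath σ B x y
    splits⇒dit-connected σ (a , b , ba , bb , a≁b) {x} {y} bx by
      with em {Partition.same σ x y} | em {Partition.same σ x a}
    ... | no x≁y  | _       = EqClosure.return (bx , by , x≁y)
    ... | yes x∼y | no x≁a  = ditPath-detour σ x∼y bx by ba x≁a
    ... | yes x∼y | yes x∼a = ditPath-detour σ x∼y bx by bb (a≁b ∘ σ.trans (σ.sym x∼a))
      where module σ = IsEquivalence (Partition.isEquivalence σ)

module OnBlock (em : ExcludedMiddle 0ℓ) {U : Set} (π : Partition U) (u : U) where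

  private
    dne = em⇒dne em
    module π = IsEquivalence (Partition.isEquivalence π)

  InBlock : U → Set
  InBlock = Block π u

  -- On the block of u the dit-set R is that of 1 if A holds and that of 0
  -- otherwise.
  record Decides (A : Set) (R : Rel U 0ℓ) : Set where
    field
      dit⊆       : dit π ⇒ R
      discrete   : A → DiscreteOn InBlock R
      indiscrete : ¬ A → IndiscreteOn InBlock R

  open Decides

  decides-cong : {A B : Set} {R : Rel U 0ℓ} → (A → B) → (B → A) → Decides A R → Decides B R
  decides-cong A⇒B B⇒A d = record
    { dit⊆       = dit⊆ d
    ; discrete   = discrete d ∘ B⇒A
    ; indiscrete = λ ¬B → indiscrete d (¬B ∘ A⇒B)
    }

  decides-int : {A : Set} {R : Rel U 0ℓ} → Decides A R → Decides A (int R)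
  decides-int d = record
    { dit⊆       = dit⊆int em π (dit⊆ d)
    ; discrete   = int-preserves-discrete em π u (dit⊆ d) ∘ discrete d
    ; indiscrete = int-preserves-indiscrete ∘ indiscrete d
    }

  decides-ditπ : Decides ⊥ (dit π)
  decides-ditπ = record
    { dit⊆       = id
    ; discrete   = ⊥-elim
    ; indiscrete = λ _ bx by _ x≁y → x≁y (π.trans bx (π.sym by))
    }

  decides-≢ : Decides ⊤ _≢_
  decides-≢ = record
    { dit⊆       = λ { x≁y refl → x≁y π.refl }
    ; discrete   = λ _ _ _ → id
    ; indiscrete = λ ¬⊤ → ⊥-elim (¬⊤ tt)
    }

  decides-⊎ : {A B : Set} {R S : Rel U 0ℓ} → Decides A R → Decides B S →
    Decides (A ⊎ B) (λ x y → R x y ⊎ S x y)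
  decides-⊎ dR dS = record
    { dit⊆       = inj₁ ∘ dit⊆ dR
    ; discrete   = λ { (inj₁ a) bx by x≢y → inj₁ (discrete dR a bx by x≢y)
                     ; (inj₂ b) bx by x≢y → inj₂ (discrete dS b bx by x≢y) }
    ; indiscrete = λ { ¬A⊎B bx by x≢y (inj₁ r) → indiscrete dR (¬A⊎B ∘ inj₁) bx by x≢y r
                     ; ¬A⊎B bx by x≢y (inj₂ s) → indiscrete dS (¬A⊎B ∘ inj₂) bx by x≢y s }
    }

  decides-× : {A B : Set} {R S : Rel U 0ℓ} → Decides A R → Decides B S →
    Decides (A × B) (λ x y → R x y × S x y)
  decides-× {A} {B} dR dS = record
    { dit⊆       = λ x≁y → dit⊆ dR x≁y , dit⊆ dS x≁y
    ; discrete   = λ (a , b) bx by x≢y → discrete dR a bx by x≢y , discrete dS b bx by x≢y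
    ; indiscrete = [ (λ ¬a {x} {y} bx by x≢y → indiscrete dR ¬a bx by x≢y ∘ proj₁)
                   , (λ ¬b {x} {y} bx by x≢y → indiscrete dS ¬b bx by x≢y ∘ proj₂)
                   ] ∘ ¬A⊎¬B
    }
    where
    ¬A⊎¬B : ¬ (A × B) → ¬ A ⊎ ¬ B
    ¬A⊎¬B ¬A×B with em {A}
    ... | yes a = inj₂ (λ b → ¬A×B (a , b))
    ... | no ¬a = inj₁ ¬a

  decides-→ : {A B : Set} {R S : Rel U 0ℓ} → Decides A R → Decides B S →
    Decides (¬ A ⊎ B) (λ x y → compl R x y ⊎ S x y)
  decides-→ dR dS = record
    { dit⊆       = inj₂ ∘ dit⊆ dS
    ; discrete   = λ { (inj₁ ¬a) bx by x≢y → inj₁ (indiscrete dR ¬a bx by x≢y)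
                     ; (inj₂ b) bx by x≢y → inj₂ (discrete dS b bx by x≢y) }
    ; indiscrete = λ { ¬→ bx by x≢y (inj₁ ¬r) → ¬r (discrete dR (dne (¬→ ∘ inj₁)) bx by x≢y)
                     ; ¬→ bx by x≢y (inj₂ s) → indiscrete dS (¬→ ∘ inj₂) bx by x≢y s }
    }

  decides-⇒π : (σ : Partition U) →
    Decides (¬ Splits σ InBlock) (int (λ x y → compl (dit σ) x y ⊎ dit π x y))
  decides-⇒π σ = record
    { dit⊆       = dit⊆int em π inj₂
    ; discrete   = λ ¬split → int-preserves-discrete em π u inj₂
                     (λ bx by _ → inj₁ (λ x≁y → ¬split (_ , _ , bx , by , x≁y)))
    ; indiscrete = λ ¬¬split bx by _ int →
        int (EqClosure.map ditInBlock⇒¬⇒π (splits⇒dit-connected em σ (dne ¬¬split) bx by))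
    }
    where
    ditInBlock⇒¬⇒π : ∀ {c d} → InBlock c × InBlock d × dit σ c d →
      ¬ (compl (dit σ) c d ⊎ dit π c d)
    ditInBlock⇒¬⇒π (bc , bd , c≁d) = [ (λ ¬c≁d → ¬c≁d c≁d) , (λ c≁d → c≁d (π.trans bc (π.sym bd))) ]

  decides-doubleNegation : (σ : Partition U) →
    Decides (Splits σ InBlock)
      (int (λ x y → compl (int (λ x y → compl (dit σ) x y ⊎ dit π x y)) x y ⊎ dit π x y))
  decides-doubleNegation σ =
    decides-cong [ dne , ⊥-elim ] (λ split → inj₁ (λ ¬split → ¬split split))
      (decides-int (decides-→ (decides-⇒π σ) decides-ditπ))

splitAssignment : {U : Set} → (ℕ → Partition U) → (U → Set) → ℕ → Subset ⊤
splitAssignment ρ B q _ = Splits (ρ q) B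

decides-dnTransform : (em : ExcludedMiddle 0ℓ) {U : Set} (ρ : ℕ → Partition U) (p : ℕ) (u : U)
  (φ : Formula) → let open OnBlock em (ρ p) u in
  Decides (evalSub (splitAssignment ρ InBlock) φ tt) (evalDit ρ (dnTransform p φ))
decides-dnTransform em ρ p u = go
  where
  open OnBlock em (ρ p) u
  go : (φ : Formula) → Decides (evalSub (splitAssignment ρ InBlock) φ tt) (evalDit ρ (dnTransform p φ))
  go (var q)  = decides-doubleNegation (ρ q)
  go zero'    = decides-ditπ
  go one'     = decides-≢
  go (φ ∨' ψ) = decides-⊎ (go φ) (go ψ)
  go (φ ∧' ψ) = decides-int (decides-× (go φ) (go ψ))
  go (φ ⇒' ψ) = decides-int (decides-→ (go φ) (go ψ))

mainTheorem15 : ExcludedMiddle 0ℓ → (φ : Formula) (p : ℕ) → ¬ Occurs p φ →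
    SubsetTautology φ → PartitionTautology (dnTransform p φ)
mainTheorem15 em φ p _ taut U _ ρ u v =
  mk⇔ (λ { d refl → evalDit-irreflexive ρ (dnTransform p φ) u d }) distinct⇒dit
  where
  open OnBlock em (ρ p) u
  open Decides (decides-dnTransform em ρ p u φ)
  module π = IsEquivalence (Partition.isEquivalence (ρ p))
  distinct⇒dit : u ≢ v → evalDit ρ (dnTransform p φ) u v
  distinct⇒dit u≢v with em {Partition.same (ρ p) u v}
  ... | yes u∼v = discrete (taut ⊤ tt (splitAssignment ρ InBlock) tt) π.refl (π.sym u∼v) u≢v
  ... | no u≁v  = dit⊆ u≁v
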